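{- Let $S$ be a finite set with $n=|S|\ge1$, let $B\subseteq\mathbb{R}^S$ be an integral base-polyhedron, and let $k$ be an integer with $1\le k\le n$. Then every decreasingly minimal element $m$ of $B\cap\mathbb{Z}^S$ minimizes, over all $y\in B\cap\mathbb{Z}^S$, the sum of the $k$ largest components of $y$.
   Context: An integral base-polyhedron is a set of the form $B=\{x\in\mathbb{R}^S:\widetilde x(S)=b(S),\ \widetilde x(Z)\le b(Z)\ \forall Z\subseteq S\}$ where $b$ is an integer-valued submodular set-function ($+\infty$ values allowed) with $b(\emptyset)=0$ and $b(S)$ finite; here $\widetilde x(Z)=\sum_{s\in Z}x(s)$. For a vector $x$, $x{\downarrow}$ is the vector with its components rearranged in decreasing order; $m\in Q$ is decreasingly minimal in $Q$ if $m{\downarrow}$ is lexicographically smaller than or equal to $y{\downarrow}$ for all $y\in Q$. -}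

module Defs where

open import Data.Nat using (ℕ; zero; suc)
open import Data.Integer as ℤ using (ℤ; _+_; 0ℤ)
import Data.Integer.Properties as ℤP
open import Data.Fin using (Fin)
import Data.Fin as Fin
open import Data.Fin.Subset using (Subset; inside; outside; _∩_; _∪_; ⊥; ⊤)
open import Data.Vec using ([]; _∷_)
open import Data.List using (List; take; foldr)
import Data.List as List
open import Data.Product using (∃; Σ; _×_)
open import Data.Unit using () renaming (⊤ to Unit)
open import Data.Empty using () renaming (⊥ to Empty)
open import Relation.Binary.PropositionalEquality using (_≡_)
open import Data.List.Relation.Binary.Lex.NonStrict using (Lex-≤)
import Relation.Binary.Properties.DecTotalOrder as DTOProps
import Data.List.Sort as Sort

data ℤ∞ : Set where
  fin : ℤ → ℤ∞
  ∞   : ℤ∞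

infixl 6 _+∞_
_+∞_ : ℤ∞ → ℤ∞ → ℤ∞
fin a +∞ fin b = fin (a + b)
fin _ +∞ ∞     = ∞
∞     +∞ _     = ∞

infix 4 _≤∞_
_≤∞_ : ℤ∞ → ℤ∞ → Set
fin a ≤∞ fin b = a ℤ.≤ b
_     ≤∞ ∞     = Unit
∞     ≤∞ fin _ = Empty

x̃ : ∀ {n} → (Fin n → ℤ) → Subset n → ℤ
x̃ {zero}  x []            = 0ℤ
x̃ {suc n} x (inside ∷ Z)  = x Fin.zero + x̃ (λ i → x (Fin.suc i)) Z
x̃ {suc n} x (outside ∷ Z) = x̃ (λ i → x (Fin.suc i)) Z

record Submodular (n : ℕ) : Set where
  field
    b        : Subset n → ℤ∞
    b-empty  : b ⊥ ≡ fin 0ℤ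
    b-full   : ∃ λ c → b ⊤ ≡ fin c
    submod   : ∀ X Y → b (X ∩ Y) +∞ b (X ∪ Y) ≤∞ b X +∞ b Y
open Submodular public

InB : ∀ {n} → Submodular n → (Fin n → ℤ) → Set
InB bf x = (fin (x̃ x ⊤) ≡ b bf ⊤) × (∀ Z → fin (x̃ x Z) ≤∞ b bf Z)

module DecSort = Sort (DTOProps.≥-decTotalOrder ℤP.≤-decTotalOrder)

_↓ : ∀ {n} → (Fin n → ℤ) → List ℤ
x ↓ = DecSort.sort (List.tabulate x)

_≤lex_ : List ℤ → List ℤ → Set
_≤lex_ = Lex-≤ _≡_ ℤ._≤_

DecMin : ∀ {n} → Submodular n → (Fin n → ℤ) → Set
DecMin bf m = InB bf m × (∀ y → InB bf y → (m ↓) ≤lex (y ↓))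

topSum : ∀ {n} → ℕ → (Fin n → ℤ) → ℤ
topSum k x = foldr _+_ 0ℤ (take k (x ↓))

-- For a level c let Φ_c(x) = Σᵢ (xᵢ − c)⁺. The k largest entries of x sum to at most k c + Φ_c(x),
-- with equality when c is the k-th largest entry of x; so it suffices that a decreasingly minimal m
-- minimises Φ_c over B ∩ ℤ^S for every c. If m t ≥ m s + 2, moving a unit from t to s would give a
-- decreasingly smaller vector, so it must leave B: some m-tight set contains s but not t. Tight sets
-- are closed under ∩ and ∪, hence some m-tight W contains every entry below c and none above c.
-- Then Φ_c(m) = Σ_{i ∉ W} (mᵢ − c), and m(S ∖ W) = b(S) − b(W) ≤ y(S ∖ W) for every y ∈ B, so
-- Φ_c(m) ≤ Σ_{i ∉ W} (yᵢ − c) ≤ Φ_c(y).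

module Submission where

open import Defs
open import Data.Nat using (ℕ; _≤_)
open import Data.Integer using (ℤ) renaming (_≤_ to _≤ℤ_)
open import Data.Fin using (Fin)

import Data.Fin as Fin
open import Data.Nat as ℕ using (zero; suc; z≤n; s≤s)
import Data.Nat.Properties as ℕP
open import Data.Integer as ℤ using (_+_; _-_; _*_; _<_; _≥_; _⊔_; 0ℤ; 1ℤ; +_)
import Data.Integer.Properties as ℤP
open import Data.Integer.Tactic.RingSolver using (solve-∀)
open import Algebra.Properties.CommutativeSemigroup ℤP.+-commutativeSemigroup
  using () renaming (interchange to +-interchange; x∙yz≈y∙xz to x+[y+z]≡y+[x+z])
open import Data.List using (List; []; _∷_; take; foldr; map; filter; length; tabulate; allFin)
open import Data.List.Properties using (filter-none; filter-accept; length-tabulate)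
open import Data.List.Relation.Unary.All as All using (All; []; _∷_)
open import Data.List.Relation.Unary.AllPairs using (AllPairs; []; _∷_)
open import Data.List.Relation.Unary.Linked.Properties using (Linked⇒AllPairs)
open import Data.List.Membership.Propositional using () renaming (_∈_ to _∈ₗ_)
open import Data.List.Membership.Propositional.Properties using (∈-filter⁺; ∈-allFin)
open import Data.List.Relation.Unary.All.Properties using (all-filter)
open import Data.List.Relation.Unary.Any using (here; there)
open import Data.List.Relation.Binary.Permutation.Propositional using (_↭_; ↭⇒↭ₛ)
open import Data.List.Relation.Binary.Permutation.Propositional.Properties using (map⁺; filter-↭; ↭-length)
import Data.List.Relation.Binary.Permutation.Setoid.Properties as PermutationProperties
import Data.List.Relation.Binary.Lex.Core as Lex
open import Data.Vec using ([]; _∷_; here; there)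
open import Data.Fin.Subset using (Subset; inside; outside; _∈_; _∉_; _∩_; _∪_; ∁; ⊤; ⊥)
open import Data.Fin.Subset.Properties using (_∈?_; anySubset?; drop-there; ∈⊤; x∈∁p⇒x∉p; x∉∁p⇒x∈p; ∉⊥; x∈p∩q⁺; x∈p∩q⁻; x∈p∪q⁺; x∈p∪q⁻)
open import Data.Unit using (tt)
open import Data.Sum using (inj₁; inj₂; [_,_]′)
open import Data.Product using (∃; ∃-syntax; _×_; _,_; proj₁; proj₂)
open import Function using (_∘_)
open import Relation.Binary.PropositionalEquality
open import Relation.Nullary using (¬_; ¬?; Dec; yes; no; contradiction; _×-dec_)
open import Relation.Nullary.Decidable using (map′)
open import Relation.Unary using (Decidable)

-- Top sums through excesses over a level

sumℤ : List ℤ → ℤ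
sumℤ = foldr _+_ 0ℤ

sumℤ-↭ : ∀ {xs ys} → xs ↭ ys → sumℤ xs ≡ sumℤ ys
sumℤ-↭ p = PermutationProperties.foldr-commMonoid (setoid ℤ) ℤP.+-0-isCommutativeMonoid (↭⇒↭ₛ p)

excess : ℤ → ℤ → ℤ
excess c a = (a - c) ⊔ 0ℤ

excessSum : ℤ → List ℤ → ℤ
excessSum c xs = sumℤ (map (excess c) xs)

excess-nonneg : ∀ c a → 0ℤ ≤ℤ excess c a
excess-nonneg c a = ℤP.i≤j⊔i (a - c) 0ℤ

≤-excess : ∀ c a → a - c ≤ℤ excess c a
≤-excess c a = ℤP.i≤i⊔j (a - c) 0ℤ

excess-below : ∀ {c a} → a ≤ℤ c → excess c a ≡ 0ℤ
excess-below a≤c = ℤP.i≤j⇒i⊔j≡j (ℤP.i≤j⇒i-j≤0 a≤c)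

excess-above : ∀ {c a} → c ≤ℤ a → excess c a ≡ a - c
excess-above c≤a = ℤP.i≥j⇒i⊔j≡i (ℤP.i≤j⇒0≤j-i c≤a)

excessSum-↭ : ∀ c {xs ys} → xs ↭ ys → excessSum c xs ≡ excessSum c ys
excessSum-↭ c p = sumℤ-↭ (map⁺ (excess c) p)

excessSum-nonneg : ∀ c xs → 0ℤ ≤ℤ excessSum c xs
excessSum-nonneg c []       = ℤP.≤-refl
excessSum-nonneg c (a ∷ xs) = ℤP.+-mono-≤ (excess-nonneg c a) (excessSum-nonneg c xs)

excessSum-below : ∀ {c xs} → All (_≤ℤ c) xs → excessSum c xs ≡ 0ℤ
excessSum-below []           = refl
excessSum-below (a≤c ∷ xs≤c) = cong₂ _+_ (excess-below a≤c) (excessSum-below xs≤c)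

pos-suc-* : ∀ k c → + suc k * c ≡ c + + k * c
pos-suc-* k c = trans (cong (_* c) (ℤP.pos-+ 1 k)) (distrib (+ k) c)
  where
  distrib : ∀ x c → (1ℤ + x) * c ≡ c + x * c
  distrib = solve-∀

sum-take≤ : ∀ c k xs → k ≤ length xs → sumℤ (take k xs) ≤ℤ + k * c + excessSum c xs
sum-take≤ c zero xs _ = begin
  0ℤ                         ≤⟨ excessSum-nonneg c xs ⟩
  excessSum c xs             ≡⟨ sym (ℤP.+-identityˡ _) ⟩
  0ℤ + excessSum c xs        ≡⟨ cong (_+ excessSum c xs) (sym (ℤP.*-zeroˡ c)) ⟩
  + 0 * c + excessSum c xs   ∎
  where open ℤP.≤-Reasoning
sum-take≤ c (suc k) (a ∷ xs) (s≤s k≤) = begin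
  a + sumℤ (take k xs)                             ≤⟨ ℤP.+-mono-≤ a≤c+excess (sum-take≤ c k xs k≤) ⟩
  (c + excess c a) + (+ k * c + excessSum c xs)    ≡⟨ regroup c (excess c a) (+ k * c) (excessSum c xs) ⟩
  (c + + k * c) + (excess c a + excessSum c xs)    ≡⟨ cong (_+ excessSum c (a ∷ xs)) (sym (pos-suc-* k c)) ⟩
  + suc k * c + excessSum c (a ∷ xs)               ∎
  where
  open ℤP.≤-Reasoning
  regroup : ∀ c e p q → (c + e) + (p + q) ≡ (c + p) + (e + q)
  regroup = solve-∀
  a≤c+excess : a ≤ℤ c + excess c a
  a≤c+excess = subst (_≤ℤ c + excess c a) (cancel c a) (ℤP.+-monoʳ-≤ c (≤-excess c a))
    where
    cancel : ∀ c a → c + (a - c) ≡ a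
    cancel = solve-∀

Descending : List ℤ → Set
Descending = AllPairs _≥_

-- Equality holds at the k-th largest entry c: every entry before it exceeds c by exactly its excess.
sum-take≡ : ∀ k xs → Descending xs → 1 ≤ k → k ≤ length xs →
            ∃[ c ] c ∈ₗ xs × sumℤ (take k xs) ≡ + k * c + excessSum c xs
sum-take≡ (suc zero) (a ∷ xs) (xs≤a ∷ _) _ _ = a , here refl , (begin
  a + 0ℤ                                   ≡⟨ normalise a ⟩
  + 1 * a + (0ℤ + 0ℤ)                      ≡⟨ cong₂ (λ e E → + 1 * a + (e + E)) (sym (excess-below {a} ℤP.≤-refl))
                                                                            (sym (excessSum-below xs≤a)) ⟩
  + 1 * a + (excess a a + excessSum a xs)  ∎)
  where
  open ≡-Reasoning
  normalise : ∀ a → a + 0ℤ ≡ 1ℤ * a + (0ℤ + 0ℤ)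
  normalise = solve-∀
sum-take≡ (suc (suc k)) (a ∷ xs) (xs≤a ∷ desc) _ (s≤s k<) with sum-take≡ (suc k) xs desc (s≤s z≤n) k<
... | c , c∈xs , eq = c , there c∈xs , (begin
  a + sumℤ (take (suc k) xs)                      ≡⟨ cong (λ s → a + s) eq ⟩
  a + (+ suc k * c + excessSum c xs)              ≡⟨ regroup a (+ suc k * c) (excessSum c xs) c ⟩
  (c + + suc k * c) + ((a - c) + excessSum c xs)  ≡⟨ cong₂ (λ u e → u + (e + excessSum c xs))
                                                           (sym (pos-suc-* (suc k) c))
                                                           (sym (excess-above (All.lookup xs≤a c∈xs))) ⟩
  + suc (suc k) * c + excessSum c (a ∷ xs)        ∎)
  where
  open ≡-Reasoning
  regroup : ∀ a p q c → a + (p + q) ≡ (c + p) + ((a - c) + q)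
  regroup = solve-∀

↓-↭ : ∀ {n} (x : Fin n → ℤ) → x ↓ ↭ tabulate x
↓-↭ x = DecSort.sort-↭ (tabulate x)

length-↓ : ∀ {n} (x : Fin n → ℤ) → length (x ↓) ≡ n
length-↓ x = trans (↭-length (↓-↭ x)) (length-tabulate x)

↓-descending : ∀ {n} (x : Fin n → ℤ) → Descending (x ↓)
↓-descending x = Linked⇒AllPairs (λ p q → ℤP.≤-trans q p) (DecSort.sort-↗ (tabulate x))

topSum≤ : ∀ {n} (x : Fin n → ℤ) c {k} → k ≤ n → topSum k x ≤ℤ + k * c + excessSum c (tabulate x)
topSum≤ x c {k} k≤n =
  subst (topSum k x ≤ℤ_) (cong (λ e → + k * c + e) (excessSum-↭ c (↓-↭ x)))
        (sum-take≤ c k (x ↓) (subst (k ≤_) (sym (length-↓ x)) k≤n))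

topSum-attained : ∀ {n} (x : Fin n → ℤ) {k} → 1 ≤ k → k ≤ n →
                  ∃[ c ] topSum k x ≡ + k * c + excessSum c (tabulate x)
topSum-attained x {k} 1≤k k≤n
  with sum-take≡ k (x ↓) (↓-descending x) 1≤k (subst (k ≤_) (sym (length-↓ x)) k≤n)
... | c , _ , eq = c , trans eq (cong (λ e → + k * c + e) (excessSum-↭ c (↓-↭ x)))

-- Counting entries above a level

count≥ : ℤ → List ℤ → ℕ
count≥ a xs = length (filter (a ℤ.≤?_) xs)

count≥-↭ : ∀ a {xs ys} → xs ↭ ys → count≥ a xs ≡ count≥ a ys
count≥-↭ a p = ↭-length (filter-↭ (a ℤ.≤?_) p)

count≥-↓ : ∀ {n} a (x : Fin n → ℤ) → count≥ a (x ↓) ≡ count≥ a (tabulate x)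
count≥-↓ a x = count≥-↭ a (↓-↭ x)

count≥-none : ∀ {a xs} → All (_< a) xs → count≥ a xs ≡ 0
count≥-none {a} xs<a = cong length (filter-none (a ℤ.≤?_) (All.map ℤP.<⇒≱ xs<a))

count≥-head : ∀ {a y} ys → a ≤ℤ y → count≥ a (y ∷ ys) ≡ suc (count≥ a ys)
count≥-head {a} ys a≤y = cong length (filter-accept (a ℤ.≤?_) {xs = ys} a≤y)

count≥-∷-cancel : ∀ a x {xs ys} → count≥ a (x ∷ xs) ≡ count≥ a (x ∷ ys) → count≥ a xs ≡ count≥ a ys
count≥-∷-cancel a x eq with a ℤ.≤? x
... | yes _ = ℕP.suc-injective eq
... | no _  = eq

count≥-∷-mono : ∀ a x {xs ys} → count≥ a xs ≤ count≥ a ys → count≥ a (x ∷ xs) ≤ count≥ a (x ∷ ys)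
count≥-∷-mono a x le with a ℤ.≤? x
... | yes _ = s≤s le
... | no _  = le

entries-< : ∀ {a x xs} → All (_≤ℤ x) xs → x < a → All (_< a) (x ∷ xs)
entries-< xs≤x x<a = x<a ∷ All.map (λ z≤x → ℤP.≤-<-trans z≤x x<a) xs≤x

≤lex⇒count≥-≤ : ∀ {v xs ys} → Descending xs → Descending ys → xs ≤lex ys →
                (∀ a → v < a → count≥ a xs ≡ count≥ a ys) → count≥ v xs ≤ count≥ v ys
≤lex⇒count≥-≤ {xs = []} _ _ _ _ = z≤n
≤lex⇒count≥-≤ {v} {x ∷ xs} {y ∷ ys} (xs≤x ∷ _) _ (Lex.this (x≤y , x≢y)) agree
  with y ℤ.≤? v | ℤP.≤∧≢⇒< x≤y x≢y
... | yes y≤v | x<y = subst (_≤ count≥ v (y ∷ ys)) (sym (count≥-none (entries-< xs≤x (ℤP.<-≤-trans x<y y≤v)))) z≤n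
... | no y≰v  | x<y = contradiction (begin
  0                     ≡⟨ count≥-none (entries-< xs≤x x<y) ⟨
  count≥ y (x ∷ xs)     ≡⟨ agree y (ℤP.≰⇒> y≰v) ⟩
  count≥ y (y ∷ ys)     ≡⟨ count≥-head ys ℤP.≤-refl ⟩
  suc (count≥ y ys)     ∎) ℕP.0≢1+n
  where open ≡-Reasoning
≤lex⇒count≥-≤ {v} {x ∷ xs} (_ ∷ dxs) (_ ∷ dys) (Lex.next refl lex) agree =
  count≥-∷-mono v x (≤lex⇒count≥-≤ dxs dys lex (λ a v<a → count≥-∷-cancel a x (agree a v<a)))

module _ {A : Set} {P : A → Set} (P? : Decidable P) where

  count-tabulate-mono : ∀ {n} (f g : Fin n → A) → (∀ i → P (g i) → P (f i)) →
                        length (filter P? (tabulate g)) ≤ length (filter P? (tabulate f))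
  count-tabulate-mono {zero}  f g g⇒f = z≤n
  count-tabulate-mono {suc n} f g g⇒f
    with P? (f Fin.zero) | P? (g Fin.zero) | count-tabulate-mono (f ∘ Fin.suc) (g ∘ Fin.suc) (g⇒f ∘ Fin.suc)
  ... | yes _ | yes _ | rest = s≤s rest
  ... | yes _ | no _  | rest = ℕP.m≤n⇒m≤1+n rest
  ... | no _  | no _  | rest = rest
  ... | no ¬f | yes g | _    = contradiction (g⇒f Fin.zero g) ¬f

  count-tabulate-mono-< : ∀ {n} (f g : Fin n → A) → (∀ i → P (g i) → P (f i)) →
                          ∀ t → P (f t) → ¬ P (g t) →
                          length (filter P? (tabulate g)) ℕ.< length (filter P? (tabulate f))
  count-tabulate-mono-< f g g⇒f Fin.zero ft ¬gt with P? (f Fin.zero) | P? (g Fin.zero)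
  ... | _     | yes g = contradiction g ¬gt
  ... | no ¬f | _     = contradiction ft ¬f
  ... | yes _ | no _  = s≤s (count-tabulate-mono (f ∘ Fin.suc) (g ∘ Fin.suc) (g⇒f ∘ Fin.suc))
  count-tabulate-mono-< f g g⇒f (Fin.suc t) ft ¬gt
    with P? (f Fin.zero) | P? (g Fin.zero) | count-tabulate-mono-< (f ∘ Fin.suc) (g ∘ Fin.suc) (g⇒f ∘ Fin.suc) t ft ¬gt
  ... | yes _ | yes _ | rest = s≤s rest
  ... | yes _ | no _  | rest = ℕP.m≤n⇒m≤1+n rest
  ... | no _  | no _  | rest = rest
  ... | no ¬f | yes g | _    = contradiction (g⇒f Fin.zero g) ¬f

x̃-+ : ∀ {n} (f g : Fin n → ℤ) Z → x̃ (λ i → f i + g i) Z ≡ x̃ f Z + x̃ g Z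
x̃-+ {zero}  f g []            = refl
x̃-+ {suc n} f g (inside ∷ Z)  = trans (cong (λ r → f Fin.zero + g Fin.zero + r) (x̃-+ (f ∘ Fin.suc) (g ∘ Fin.suc) Z))
                                      (+-interchange (f Fin.zero) (g Fin.zero) _ _)
x̃-+ {suc n} f g (outside ∷ Z) = x̃-+ (f ∘ Fin.suc) (g ∘ Fin.suc) Z

x̃-- : ∀ {n} (f g : Fin n → ℤ) Z → x̃ (λ i → f i - g i) Z ≡ x̃ f Z - x̃ g Z
x̃-- {zero}  f g []            = refl
x̃-- {suc n} f g (inside ∷ Z)  = trans (cong (λ r → f Fin.zero - g Fin.zero + r) (x̃-- (f ∘ Fin.suc) (g ∘ Fin.suc) Z))
                                      (interchange (f Fin.zero) (g Fin.zero) _ _)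
  where
  interchange : ∀ a b c d → (a - b) + (c - d) ≡ (a + c) - (b + d)
  interchange = solve-∀
x̃-- {suc n} f g (outside ∷ Z) = x̃-- (f ∘ Fin.suc) (g ∘ Fin.suc) Z

x̃-0 : ∀ {n} (Z : Subset n) → x̃ (λ _ → 0ℤ) Z ≡ 0ℤ
x̃-0 []            = refl
x̃-0 (inside ∷ Z)  = trans (ℤP.+-identityˡ _) (x̃-0 Z)
x̃-0 (outside ∷ Z) = x̃-0 Z

x̃-⊥ : ∀ {n} (x : Fin n → ℤ) → x̃ x ⊥ ≡ 0ℤ
x̃-⊥ {zero}  x = refl
x̃-⊥ {suc n} x = x̃-⊥ (x ∘ Fin.suc)

x̃-∁ : ∀ {n} (x : Fin n → ℤ) Z → x̃ x Z + x̃ x (∁ Z) ≡ x̃ x ⊤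
x̃-∁ {zero}  x []            = refl
x̃-∁ {suc n} x (inside ∷ Z)  = trans (ℤP.+-assoc (x Fin.zero) _ _) (cong (λ r → x Fin.zero + r) (x̃-∁ (x ∘ Fin.suc) Z))
x̃-∁ {suc n} x (outside ∷ Z) = trans (x+[y+z]≡y+[x+z] (x̃ (x ∘ Fin.suc) Z) (x Fin.zero) _) (cong (λ r → x Fin.zero + r) (x̃-∁ (x ∘ Fin.suc) Z))

x̃-∩-∪ : ∀ {n} (x : Fin n → ℤ) X Y → x̃ x (X ∩ Y) + x̃ x (X ∪ Y) ≡ x̃ x X + x̃ x Y
x̃-∩-∪ {zero}  x [] [] = refl
x̃-∩-∪ {suc n} x (inside ∷ X) (inside ∷ Y) =
  trans (+-interchange a _ a _) (trans (cong (λ r → a + a + r) (x̃-∩-∪ (x ∘ Fin.suc) X Y)) (sym (+-interchange a _ a _)))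
  where a = x Fin.zero
x̃-∩-∪ {suc n} x (inside ∷ X) (outside ∷ Y) =
  trans (x+[y+z]≡y+[x+z] (x̃ x′ (X ∩ Y)) a _) (trans (cong (λ r → a + r) (x̃-∩-∪ x′ X Y)) (sym (ℤP.+-assoc a _ _)))
  where
  a = x Fin.zero
  x′ = x ∘ Fin.suc
x̃-∩-∪ {suc n} x (outside ∷ X) (inside ∷ Y) =
  trans (x+[y+z]≡y+[x+z] (x̃ x′ (X ∩ Y)) a _) (trans (cong (λ r → a + r) (x̃-∩-∪ x′ X Y)) (sym (x+[y+z]≡y+[x+z] (x̃ x′ X) a _)))
  where
  a = x Fin.zero
  x′ = x ∘ Fin.suc
x̃-∩-∪ {suc n} x (outside ∷ X) (outside ∷ Y) = x̃-∩-∪ (x ∘ Fin.suc) X Y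

x̃-excess-≤ : ∀ {n} (x : Fin n → ℤ) c Z → x̃ (λ i → x i - c) Z ≤ℤ excessSum c (tabulate x)
x̃-excess-≤ {zero}  x c []            = ℤP.≤-refl
x̃-excess-≤ {suc n} x c (inside ∷ Z)  = ℤP.+-mono-≤ (≤-excess c (x Fin.zero)) (x̃-excess-≤ (x ∘ Fin.suc) c Z)
x̃-excess-≤ {suc n} x c (outside ∷ Z) = subst (_≤ℤ _) (ℤP.+-identityˡ _)
  (ℤP.+-mono-≤ (excess-nonneg c (x Fin.zero)) (x̃-excess-≤ (x ∘ Fin.suc) c Z))

x̃-excess-≡ : ∀ {n} (x : Fin n → ℤ) c Z → (∀ i → i ∈ Z → c ≤ℤ x i) → (∀ i → i ∉ Z → x i ≤ℤ c) →
             x̃ (λ i → x i - c) Z ≡ excessSum c (tabulate x)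
x̃-excess-≡ {zero}  x c []            _     _     = refl
x̃-excess-≡ {suc n} x c (inside ∷ Z)  above below =
  cong₂ _+_ (sym (excess-above (above Fin.zero here)))
            (x̃-excess-≡ (x ∘ Fin.suc) c Z (λ i → above (Fin.suc i) ∘ there) (λ i i∉Z → below (Fin.suc i) (i∉Z ∘ drop-there)))
x̃-excess-≡ {suc n} x c (outside ∷ Z) above below =
  trans (sym (ℤP.+-identityˡ _))
        (cong₂ _+_ (sym (excess-below (below Fin.zero λ ())))
                   (x̃-excess-≡ (x ∘ Fin.suc) c Z (λ i → above (Fin.suc i) ∘ there) (λ i i∉Z → below (Fin.suc i) (i∉Z ∘ drop-there))))

-- Tight sets

fin-injective : ∀ {a a′} → fin a ≡ fin a′ → a ≡ a′
fin-injective refl = refl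

≤-≤∞-trans : ∀ {a a′ p} → a ≤ℤ a′ → fin a′ ≤∞ p → fin a ≤∞ p
≤-≤∞-trans {p = fin β} a≤a′ a′≤β = ℤP.≤-trans a≤a′ a′≤β
≤-≤∞-trans {p = ∞}     _     _     = tt

≤∞∧≢⇒+1≤∞ : ∀ {a p} → fin a ≤∞ p → fin a ≢ p → fin (a + 1ℤ) ≤∞ p
≤∞∧≢⇒+1≤∞ {a} {fin β} a≤β a≢β = subst (_≤ℤ β) (ℤP.+-comm 1ℤ a) (ℤP.i<j⇒suc[i]≤j (ℤP.≤∧≢⇒< a≤β (a≢β ∘ cong fin)))
≤∞∧≢⇒+1≤∞ {p = ∞}     _   _   = tt

Tight : ∀ {n} → Submodular n → (Fin n → ℤ) → Subset n → Set
Tight bf x Z = fin (x̃ x Z) ≡ b bf Z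

≤∞-squeeze : ∀ {a₁ a₂} p q → fin a₁ ≤∞ p → fin a₂ ≤∞ q → p +∞ q ≤∞ fin (a₁ + a₂) → fin a₁ ≡ p × fin a₂ ≡ q
≤∞-squeeze (fin β₁) (fin β₂) a₁≤β₁ a₂≤β₂ β≤a =
    cong fin (ℤP.≤-antisym a₁≤β₁ (ℤP.≮⇒≥ λ a₁<β₁ → ℤP.<⇒≱ (ℤP.+-mono-<-≤ a₁<β₁ a₂≤β₂) β≤a))
  , cong fin (ℤP.≤-antisym a₂≤β₂ (ℤP.≮⇒≥ λ a₂<β₂ → ℤP.<⇒≱ (ℤP.+-mono-≤-< a₁≤β₁ a₂<β₂) β≤a))
≤∞-squeeze (fin _) ∞ _ _ ()
≤∞-squeeze ∞       _ _ _ ()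

tight? : ∀ {n} (bf : Submodular n) x Z → Dec (Tight bf x Z)
tight? bf x Z with b bf Z
... | fin β = map′ (cong fin) fin-injective (x̃ x Z ℤ.≟ β)
... | ∞     = no λ ()

tight-⊥ : ∀ {n} (bf : Submodular n) x → Tight bf x ⊥
tight-⊥ bf x = trans (cong fin (x̃-⊥ x)) (sym (b-empty bf))

tight-∁-≤ : ∀ {n} (bf : Submodular n) {x y W} → InB bf x → InB bf y → Tight bf x W → x̃ x (∁ W) ≤ℤ x̃ y (∁ W)
tight-∁-≤ bf {x} {y} {W} (x⊤ , _) (y⊤ , y≤b) tW = ℤP.≮⇒≥ λ y∁<x∁ → ℤP.<-irrefl totals (begin-strict
  x̃ y ⊤                    ≡⟨ x̃-∁ y W ⟨
  x̃ y W + x̃ y (∁ W)        <⟨ ℤP.+-mono-≤-< (subst (fin (x̃ y W) ≤∞_) (sym tW) (y≤b W)) y∁<x∁ ⟩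
  x̃ x W + x̃ x (∁ W)        ≡⟨ x̃-∁ x W ⟩
  x̃ x ⊤                    ∎)
  where
  open ℤP.≤-Reasoning
  totals : x̃ y ⊤ ≡ x̃ x ⊤
  totals = fin-injective (trans y⊤ (sym x⊤))

Separates : ∀ {n} → Submodular n → (Fin n → ℤ) → Fin n → Fin n → Subset n → Set
Separates bf x s t Z = Tight bf x Z × s ∈ Z × t ∉ Z

module _ {n} (bf : Submodular n) {x : Fin n → ℤ} (x∈B : InB bf x) where

  tight-∩-∪ : ∀ {X Y} → Tight bf x X → Tight bf x Y → Tight bf x (X ∩ Y) × Tight bf x (X ∪ Y)
  tight-∩-∪ {X} {Y} tX tY = ≤∞-squeeze (b bf (X ∩ Y)) (b bf (X ∪ Y)) (proj₂ x∈B (X ∩ Y)) (proj₂ x∈B (X ∪ Y))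
    (subst (b bf (X ∩ Y) +∞ b bf (X ∪ Y) ≤∞_)
           (trans (cong₂ _+∞_ (sym tX) (sym tY)) (cong fin (sym (x̃-∩-∪ x X Y))))
           (submod bf X Y))

  tight-⋂-separators : ∀ {s} ts → All (λ t → ∃ (Separates bf x s t)) ts →
                       ∃[ Z ] Tight bf x Z × s ∈ Z × All (_∉ Z) ts
  tight-⋂-separators []       []                            = ⊤ , proj₁ x∈B , ∈⊤ , []
  tight-⋂-separators (t ∷ ts) ((Z , tZ , s∈Z , t∉Z) ∷ seps) with tight-⋂-separators ts seps
  ... | W , tW , s∈W , ts∉W =
    Z ∩ W , proj₁ (tight-∩-∪ tZ tW) , x∈p∩q⁺ (s∈Z , s∈W) ,
    (t∉Z ∘ proj₁ ∘ x∈p∩q⁻ Z W) ∷ All.map (λ u∉W → u∉W ∘ proj₂ ∘ x∈p∩q⁻ Z W) ts∉W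

  tight-⋃⋂-separators : ∀ ss ts → All (λ s → All (λ t → ∃ (Separates bf x s t)) ts) ss →
                        ∃[ Z ] Tight bf x Z × All (_∈ Z) ss × All (_∉ Z) ts
  tight-⋃⋂-separators []       ts []             = ⊥ , tight-⊥ bf x , [] , All.tabulate (λ _ → ∉⊥)
  tight-⋃⋂-separators (s ∷ ss) ts (seps ∷ sepss)
    with tight-⋂-separators ts seps | tight-⋃⋂-separators ss ts sepss
  ... | Z , tZ , s∈Z , ts∉Z | W , tW , ss∈W , ts∉W =
    Z ∪ W , proj₂ (tight-∩-∪ tZ tW) , x∈p∪q⁺ (inj₁ s∈Z) ∷ All.map (x∈p∪q⁺ ∘ inj₂) ss∈W ,
    All.zipWith (λ (t∉Z , t∉W) → [ t∉Z , t∉W ]′ ∘ x∈p∪q⁻ Z W) (ts∉Z , ts∉W)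

-- Unit moves

unit : ∀ {n} → Fin n → Fin n → ℤ
unit Fin.zero    Fin.zero    = 1ℤ
unit Fin.zero    (Fin.suc _) = 0ℤ
unit (Fin.suc _) Fin.zero    = 0ℤ
unit (Fin.suc s) (Fin.suc i) = unit s i

unit-same : ∀ {n} (s : Fin n) → unit s s ≡ 1ℤ
unit-same Fin.zero    = refl
unit-same (Fin.suc s) = unit-same s

unit-other : ∀ {n} {s i : Fin n} → s ≢ i → unit s i ≡ 0ℤ
unit-other {s = Fin.zero}  {Fin.zero}  s≢i = contradiction refl s≢i
unit-other {s = Fin.zero}  {Fin.suc _} _   = refl
unit-other {s = Fin.suc _} {Fin.zero}  _   = refl
unit-other {s = Fin.suc _} {Fin.suc _} s≢i = unit-other (s≢i ∘ cong Fin.suc)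

x̃-unit-∈ : ∀ {n} {s : Fin n} {Z} → s ∈ Z → x̃ (unit s) Z ≡ 1ℤ
x̃-unit-∈ {s = Fin.zero}  {inside ∷ Z}  here      = cong (λ r → 1ℤ + r) (x̃-0 Z)
x̃-unit-∈ {s = Fin.suc s} {inside ∷ Z}  (there p) = trans (ℤP.+-identityˡ _) (x̃-unit-∈ p)
x̃-unit-∈ {s = Fin.suc s} {outside ∷ Z} (there p) = x̃-unit-∈ p

x̃-unit-∉ : ∀ {n} {s : Fin n} {Z} → s ∉ Z → x̃ (unit s) Z ≡ 0ℤ
x̃-unit-∉ {s = Fin.zero}  {inside ∷ Z}  s∉ = contradiction here s∉
x̃-unit-∉ {s = Fin.zero}  {outside ∷ Z} _  = x̃-0 Z
x̃-unit-∉ {s = Fin.suc s} {inside ∷ Z}  s∉ = trans (ℤP.+-identityˡ _) (x̃-unit-∉ (s∉ ∘ there))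
x̃-unit-∉ {s = Fin.suc s} {outside ∷ Z} s∉ = x̃-unit-∉ (s∉ ∘ there)

moveUnit : ∀ {n} → (Fin n → ℤ) → Fin n → Fin n → Fin n → ℤ
moveUnit x t s i = x i + (unit s i - unit t i)

x̃-moveUnit : ∀ {n} (x : Fin n → ℤ) t s Z → x̃ (moveUnit x t s) Z ≡ x̃ x Z + (x̃ (unit s) Z - x̃ (unit t) Z)
x̃-moveUnit x t s Z = trans (x̃-+ x _ Z) (cong (λ r → x̃ x Z + r) (x̃-- (unit s) (unit t) Z))

-- Moving a unit from t to s raises x̃(Z) by one if s ∈ Z and t ∉ Z, and does not raise it otherwise.
moveUnit-∈B : ∀ {n} (bf : Submodular n) {x t s} → InB bf x →
              (∀ Z → s ∈ Z → t ∉ Z → ¬ Tight bf x Z) → InB bf (moveUnit x t s)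
moveUnit-∈B bf {x} {t} {s} (x⊤ , x≤b) untight = moved⊤ , moved≤b
  where
  moved⊤ : fin (x̃ (moveUnit x t s) ⊤) ≡ b bf ⊤
  moved⊤ rewrite x̃-moveUnit x t s ⊤ | x̃-unit-∈ {s = s} ∈⊤ | x̃-unit-∈ {s = t} ∈⊤ =
    trans (cong fin (ℤP.+-identityʳ _)) x⊤
  lowered : ∀ {Z δ} → δ ≤ℤ 0ℤ → fin (x̃ x Z + δ) ≤∞ b bf Z
  lowered {Z} δ≤0 = ≤-≤∞-trans (ℤP.≤-trans (ℤP.+-monoʳ-≤ (x̃ x Z) δ≤0) (ℤP.≤-reflexive (ℤP.+-identityʳ _))) (x≤b Z)
  moved≤b : ∀ Z → fin (x̃ (moveUnit x t s) Z) ≤∞ b bf Z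
  moved≤b Z rewrite x̃-moveUnit x t s Z with s ∈? Z | t ∈? Z
  ... | yes s∈ | no t∉ rewrite x̃-unit-∈ s∈ | x̃-unit-∉ t∉ = ≤∞∧≢⇒+1≤∞ (x≤b Z) (untight Z s∈ t∉)
  ... | yes s∈ | yes t∈ rewrite x̃-unit-∈ s∈ | x̃-unit-∈ t∈ = lowered ℤP.≤-refl
  ... | no s∉  | yes t∈ rewrite x̃-unit-∉ s∉ | x̃-unit-∈ t∈ = lowered ℤ.-≤+
  ... | no s∉  | no t∉ rewrite x̃-unit-∉ s∉ | x̃-unit-∉ t∉ = lowered ℤP.≤-refl

-- The move leaves the number of entries ≥ a unchanged for every a > x t and lowers it for a = x t,
-- so the moved vector is decreasingly smaller.
module _ {n} (x : Fin n → ℤ) {t s : Fin n} (gap : ℤ.suc (x s) < x t) where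

  private
    x′ = moveUnit x t s

    s<t : x s < x t
    s<t = ℤP.≤-<-trans (ℤP.i≤suc[i] (x s)) gap

    s≢t : s ≢ t
    s≢t refl = ℤP.<-irrefl refl s<t

    at-s : x′ s ≡ ℤ.suc (x s)
    at-s rewrite unit-same s | unit-other (s≢t ∘ sym) = ℤP.+-comm (x s) 1ℤ

    at-t : x′ t ≡ ℤ.pred (x t)
    at-t rewrite unit-same t | unit-other s≢t = ℤP.+-comm (x t) ℤ.-1ℤ

    elsewhere : ∀ {i} → i ≢ s → i ≢ t → x′ i ≡ x i
    elsewhere i≢s i≢t rewrite unit-other (i≢s ∘ sym) | unit-other (i≢t ∘ sym) = ℤP.+-identityʳ _

    from-below : ∀ {a} i → x t ≤ℤ a → a ≤ℤ x′ i → a ≤ℤ x i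
    from-below i xt≤a a≤x′i with i Fin.≟ s | i Fin.≟ t
    ... | yes refl | _        = contradiction (subst (_ ≤ℤ_) at-s a≤x′i) (ℤP.<⇒≱ (ℤP.<-≤-trans gap xt≤a))
    ... | no _     | yes refl = ℤP.<⇒≤ (ℤP.i≤pred[j]⇒i<j (subst (_ ≤ℤ_) at-t a≤x′i))
    ... | no i≢s   | no i≢t   = subst (_ ≤ℤ_) (elsewhere i≢s i≢t) a≤x′i

    from-above : ∀ {a} i → x t < a → a ≤ℤ x i → a ≤ℤ x′ i
    from-above {a} i xt<a a≤xi = subst (a ≤ℤ_) (sym (elsewhere i≢s i≢t)) a≤xi
      where
      i≢s : i ≢ s
      i≢s refl = ℤP.<⇒≱ (ℤP.<-trans s<t xt<a) a≤xi
      i≢t : i ≢ t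
      i≢t refl = ℤP.<⇒≱ xt<a a≤xi

    t-dropped : ¬ (x t ≤ℤ x′ t)
    t-dropped xt≤x′t = ℤP.<-irrefl refl (ℤP.i≤pred[j]⇒i<j (subst (x t ≤ℤ_) at-t xt≤x′t))

  moveUnit-¬≤lex : ¬ ((x ↓) ≤lex (moveUnit x t s ↓))
  moveUnit-¬≤lex x↓≤x′↓ = ℕP.<⇒≱ fewer (≤lex⇒count≥-≤ (↓-descending x) (↓-descending x′) x↓≤x′↓ agree)
    where
    open ≡-Reasoning
    agree : ∀ a → x t < a → count≥ a (x ↓) ≡ count≥ a (x′ ↓)
    agree a xt<a = begin
      count≥ a (x ↓)            ≡⟨ count≥-↓ a x ⟩
      count≥ a (tabulate x)     ≡⟨ ℕP.≤-antisym (count-tabulate-mono (a ℤ.≤?_) x′ x (λ i → from-above i xt<a))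
                                                (count-tabulate-mono (a ℤ.≤?_) x x′ (λ i → from-below i (ℤP.<⇒≤ xt<a))) ⟩
      count≥ a (tabulate x′)    ≡⟨ count≥-↓ a x′ ⟨
      count≥ a (x′ ↓)           ∎
    fewer : count≥ (x t) (x′ ↓) ℕ.< count≥ (x t) (x ↓)
    fewer = subst₂ ℕ._<_ (sym (count≥-↓ (x t) x′)) (sym (count≥-↓ (x t) x))
              (count-tabulate-mono-< (x t ℤ.≤?_) x x′ (λ i → from-below i ℤP.≤-refl) t ℤP.≤-refl t-dropped)

decMin⇒separated : ∀ {n} (bf : Submodular n) {m} → DecMin bf m →
                   ∀ {s t} → ℤ.suc (m s) < m t → ∃ (Separates bf m s t)
decMin⇒separated bf {m} (m∈B , m-min) {s} {t} gap
  with anySubset? (λ Z → tight? bf m Z ×-dec (s ∈? Z ×-dec ¬? (t ∈? Z)))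
... | yes separated = separated
... | no ¬separated = contradiction (m-min _ (moveUnit-∈B bf m∈B untight)) (moveUnit-¬≤lex m gap)
  where
  untight : ∀ Z → s ∈ Z → t ∉ Z → ¬ Tight bf m Z
  untight Z s∈Z t∉Z tZ = ¬separated (Z , tZ , s∈Z , t∉Z)

-- W is the union, over the entries s below c, of the intersections of the tight sets separating s
-- from the entries above c.
level-set-tight : ∀ {n} (bf : Submodular n) {m} → DecMin bf m → ∀ c →
                  ∃[ W ] Tight bf m W × (∀ i → m i < c → i ∈ W) × (∀ i → c < m i → i ∉ W)
level-set-tight {n} bf {m} dm c =
  let W , tW , lows∈W , highs∉W = tight-⋃⋂-separators bf (proj₁ dm) lows highs separated
  in  W , tW , (λ i mi<c → All.lookup lows∈W (∈-filter⁺ low? (∈-allFin i) mi<c))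
             , (λ i c<mi → All.lookup highs∉W (∈-filter⁺ high? (∈-allFin i) c<mi))
  where
  low? : ∀ i → Dec (m i < c)
  low? i = m i ℤ.<? c
  high? : ∀ i → Dec (c < m i)
  high? i = c ℤ.<? m i
  lows highs : List (Fin n)
  lows  = filter low? (allFin n)
  highs = filter high? (allFin n)
  separated : All (λ s → All (λ t → ∃ (Separates bf m s t)) highs) lows
  separated = All.map (λ ms<c → All.map (λ c<mt → decMin⇒separated bf dm (ℤP.≤-<-trans (ℤP.i<j⇒suc[i]≤j ms<c) c<mt))
                                         (all-filter high? (allFin n)))
                      (all-filter low? (allFin n))

decMin-minimizes-excessSum : ∀ {n} (bf : Submodular n) {m y} → DecMin bf m → InB bf y →
                             ∀ c → excessSum c (tabulate m) ≤ℤ excessSum c (tabulate y)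
decMin-minimizes-excessSum bf {m} {y} dm y∈B c =
  let W , tW , lows∈W , highs∉W = level-set-tight bf dm c
      above : ∀ i → i ∈ ∁ W → c ≤ℤ m i
      above i i∈∁W = ℤP.≮⇒≥ λ mi<c → x∈∁p⇒x∉p i∈∁W (lows∈W i mi<c)
      below : ∀ i → i ∉ ∁ W → m i ≤ℤ c
      below i i∉∁W = ℤP.≮⇒≥ λ c<mi → highs∉W i c<mi (x∉∁p⇒x∈p i∉∁W)
  in begin
  excessSum c (tabulate m)               ≡⟨ x̃-excess-≡ m c (∁ W) above below ⟨
  x̃ (λ i → m i - c) (∁ W)               ≡⟨ x̃-- m (λ _ → c) (∁ W) ⟩
  x̃ m (∁ W) - x̃ (λ _ → c) (∁ W)         ≤⟨ ℤP.+-monoˡ-≤ _ (tight-∁-≤ bf (proj₁ dm) y∈B tW) ⟩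
  x̃ y (∁ W) - x̃ (λ _ → c) (∁ W)         ≡⟨ x̃-- y (λ _ → c) (∁ W) ⟨
  x̃ (λ i → y i - c) (∁ W)               ≤⟨ x̃-excess-≤ y c (∁ W) ⟩
  excessSum c (tabulate y)               ∎
  where open ℤP.≤-Reasoning

theorem3p5 : (n : ℕ) → 1 ≤ n → (bf : Submodular n) → (k : ℕ) → 1 ≤ k → k ≤ n →
    (m : Fin n → ℤ) → DecMin bf m →
    (y : Fin n → ℤ) → InB bf y → topSum k m ≤ℤ topSum k y
theorem3p5 n _ bf k 1≤k k≤n m dm y y∈B =
  let c , topSum-y = topSum-attained y 1≤k k≤n
  in begin
  topSum k m                             ≤⟨ topSum≤ m c k≤n ⟩
  + k * c + excessSum c (tabulate m)     ≤⟨ ℤP.+-monoʳ-≤ (+ k * c) (decMin-minimizes-excessSum bf dm y∈B c) ⟩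
  + k * c + excessSum c (tabulate y)     ≡⟨ topSum-y ⟨
  topSum k y                             ∎
  where open ℤP.≤-Reasoning
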